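{- If $G$ is a strongly connected prime tournament, then $G$ is triangle-connected.
   Context: A tournament has exactly one directed edge between any two distinct vertices. A homogeneous set of $G$ is $X\subseteq V(G)$ such that each $v\notin X$ either beats all of $X$ or is beaten by all of $X$; it is nontrivial if $1<|X|<|V(G)|$; $G$ is prime if it has no nontrivial homogeneous set. Two cyclic triangles (directed 3-cycles) of $G$ are adjacent if they share exactly two vertices; $C,C'$ are triangle-connected to each other if there is a sequence $C_1,\dots,C_n$ ($n\ge1$) of cyclic triangles with $C_1=C$, $C_n=C'$ and $C_i$ adjacent to $C_{i+1}$ for all $i$. A tournament is triangle-connected if it is strongly connected and any two of its cyclic triangles are triangle-connected to each other. -}

module Defs where

open import Data.Nat using (ℕ; _<_)
open import Data.Fin using (Fin)
open import Data.Fin.Subset using (Subset; _∈_; _∉_; ∣_∣)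
open import Data.Product using (Σ; _×_; ∃; ∃-syntax; _,_)
open import Data.Sum using (_⊎_)
open import Data.Empty using (⊥)
open import Relation.Nullary using (¬_)
open import Relation.Binary.PropositionalEquality using (_≡_; _≢_)
open import Data.Bool using (Bool; T)

-- A digraph on vertex set Fin n, given by its (Boolean) adjacency matrix:
-- edge u → v ("u beats v") iff T (G u v).
Adj : ℕ → Set
Adj n = Fin n → Fin n → Bool

Digraph : ℕ → Set₁
Digraph n = Fin n → Fin n → Set

edge : ∀ {n} → Adj n → Digraph n
edge G u v = T (G u v)

record IsTournament {n : ℕ} (E : Digraph n) : Set where
  field
    irrefl   : ∀ u → ¬ E u u
    total    : ∀ u v → u ≢ v → E u v ⊎ E v u
    antisym  : ∀ u v → E u v → ¬ E v u

data Reach {n : ℕ} (E : Digraph n) : Fin n → Fin n → Set where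
  here  : ∀ {u} → Reach E u u
  step  : ∀ {u v w} → E u v → Reach E v w → Reach E u w

StronglyConnected : ∀ {n} → Digraph n → Set
StronglyConnected E = ∀ u v → Reach E u v

Homogeneous : ∀ {n} → Digraph n → Subset n → Set
Homogeneous E X = ∀ v → v ∉ X → (∀ x → x ∈ X → E v x) ⊎ (∀ x → x ∈ X → E x v)

Nontrivial : ∀ {n} → Subset n → Set
Nontrivial {n} X = 1 < ∣ X ∣ × ∣ X ∣ < n

Prime : ∀ {n} → Digraph n → Set
Prime E = ∀ X → Homogeneous E X → ¬ Nontrivial X

record CyclicTriangle {n : ℕ} (E : Digraph n) : Set where
  constructor cyc
  field
    a b c : Fin n
    ab : E a b
    bc : E b c
    ca : E c a

_∈▵_ : ∀ {n} {E : Digraph n} → Fin n → CyclicTriangle E → Set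
v ∈▵ C = v ≡ CyclicTriangle.a C ⊎ v ≡ CyclicTriangle.b C ⊎ v ≡ CyclicTriangle.c C

-- share exactly two vertices (triangle vertices are automatically distinct
-- in a tournament, by irreflexivity/antisymmetry)
Adjacent : ∀ {n} {E : Digraph n} → CyclicTriangle E → CyclicTriangle E → Set
Adjacent C D =
  (∃[ x ] ∃[ y ] (x ≢ y × x ∈▵ C × x ∈▵ D × y ∈▵ C × y ∈▵ D))
  × (∃[ z ] (z ∈▵ C × ¬ (z ∈▵ D)))

-- same triangle (same vertex set; the ordered-triple representation
-- distinguishes the three rotations of one cyclic triangle)
SameTriangle : ∀ {n} {E : Digraph n} → CyclicTriangle E → CyclicTriangle E → Set
SameTriangle C D = ∀ v → (v ∈▵ C → v ∈▵ D) × (v ∈▵ D → v ∈▵ C)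

data TriConn {n : ℕ} {E : Digraph n} : CyclicTriangle E → CyclicTriangle E → Set where
  tc-same : ∀ {C D} → SameTriangle C D → TriConn C D
  tc-step : ∀ {C D F} → Adjacent C D → TriConn D F → TriConn C F

TriangleConnected : ∀ {n} → Digraph n → Set
TriangleConnected E = StronglyConnected E × (∀ (C D : CyclicTriangle E) → TriConn C D)

-- Fix a cyclic triangle B. The vertices lying on some triangle connected to B form a
-- set X with at least two elements. If a vertex v ∉ X beat some x ∈ X and were beaten by some
-- y ∈ X, then following a chain of adjacent triangles from B towards x or y, the relation of v
-- to the current triangle must stop being uniform, and at that point v closes a cyclic triangle
-- with an edge of the current triangle; so v ∈ X. Hence X is homogeneous, and primality forces
-- X to be everything: every vertex lies on a triangle connected to B. Two triangles through a
-- common vertex a, say a p₁ q₁ and a p₂ q₂, are then linked by an explicit chain of triangles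
-- on {a, p₁, q₁, p₂, q₂}, except when one of them, say a p₁ q₁, lies entirely inside
-- {w : q₂ → w → p₂}; there the same crossing argument, run from a p₁ q₁ towards a triangle
-- containing p₂, produces a triangle containing the edge p₂ → q₂.
module Submission where

open import Defs
open import Data.Nat using (ℕ; _<_)
open import Data.Nat.Properties using (≤-antisym; ≮⇒≥)
open import Data.Fin using (Fin; _≟_)
open import Data.Fin.Properties using (any?)
open import Data.Fin.Subset using (Subset; _∈_; _∉_; _⊆_; _⊃_; ∣_∣; ⊤)
open import Data.Fin.Subset.Properties
  using (_∈?_; _⊂?_; ∣p∣≤n; p⊂q⇒∣p∣<∣q∣; ∣p∣≡n⇒p≡⊤; ∈⊤; ∣⁅x⁆∣≡1; x∈⁅y⁆⇒x≡y; x≢y⇒x∉⁅y⁆)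
open import Data.Fin.Subset.Induction using (⊃-wellFounded)
open import Data.Vec using (tabulate)
open import Data.Vec.Properties using (lookup∘tabulate; []=⇒lookup; lookup⇒[]=)
open import Data.Product using (Σ-syntax; _×_; ∃; _,_; proj₁; proj₂; uncurry)
open import Data.Sum using (_⊎_; inj₁; inj₂)
open import Data.Empty using (⊥; ⊥-elim)
open import Data.Bool using (true; T)
open import Function using (id; _∘′_)
open import Induction.WellFounded using (Acc; acc)
open import Relation.Nullary using (¬_; Dec; yes; no; does)
open import Relation.Nullary.Decidable using (T?; dec-true; decidable-stable; ¬?; _⊎-dec_; _×-dec_)
open import Relation.Unary using (Decidable)
open import Relation.Binary.Definitions using (DecidableEquality)
open import Relation.Binary.PropositionalEquality using (_≡_; _≢_; refl; sym; trans; subst)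

pattern 1st = inj₁ refl
pattern 2nd = inj₂ (inj₁ refl)
pattern 3rd = inj₂ (inj₂ refl)

module _ {A : Set} where

  OneOf : A → A → A → A → Set
  OneOf v a b c = v ≡ a ⊎ v ≡ b ⊎ v ≡ c

  rotate : ∀ {v a b c} → OneOf v a b c → OneOf v b c a
  rotate (inj₁ e)        = inj₂ (inj₂ e)
  rotate (inj₂ (inj₁ e)) = inj₁ e
  rotate (inj₂ (inj₂ e)) = inj₂ (inj₁ e)

  rotate⁻¹ : ∀ {v a b c} → OneOf v b c a → OneOf v a b c
  rotate⁻¹ = rotate ∘′ rotate

  private
    pigeonhole : ∀ {a b c p q : A} → a ≢ b → b ≢ c → c ≢ a →
                 (a ≡ p ⊎ a ≡ q) → (b ≡ p ⊎ b ≡ q) → (c ≡ p ⊎ c ≡ q) → ⊥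
    pigeonhole a≢b _   _   (inj₁ refl) (inj₁ refl) _           = a≢b refl
    pigeonhole _   _   c≢a (inj₁ refl) (inj₂ refl) (inj₁ refl) = c≢a refl
    pigeonhole _   b≢c _   (inj₁ refl) (inj₂ refl) (inj₂ refl) = b≢c refl
    pigeonhole _   b≢c _   (inj₂ refl) (inj₁ refl) (inj₁ refl) = b≢c refl
    pigeonhole _   _   c≢a (inj₂ refl) (inj₁ refl) (inj₂ refl) = c≢a refl
    pigeonhole a≢b _   _   (inj₂ refl) (inj₂ refl) _           = a≢b refl

    other-than : ∀ {x p q r : A} → OneOf x p q r → p ≢ x → x ≡ q ⊎ x ≡ r
    other-than (inj₁ x≡p) p≢x = ⊥-elim (p≢x (sym x≡p))
    other-than (inj₂ x∈qr) _  = x∈qr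

    first-covered : ∀ {a b c p q r : A} → DecidableEquality A → a ≢ b → b ≢ c → c ≢ a →
                    OneOf a p q r → OneOf b p q r → OneOf c p q r → OneOf p a b c
    first-covered {a} {b} {c} {p} _≟_ a≢b b≢c c≢a a∈ b∈ c∈ with p ≟ a | p ≟ b | p ≟ c
    ... | yes p≡a | _       | _       = inj₁ p≡a
    ... | no _    | yes p≡b | _       = inj₂ (inj₁ p≡b)
    ... | no _    | no _    | yes p≡c = inj₂ (inj₂ p≡c)
    ... | no p≢a  | no p≢b  | no p≢c  =
      ⊥-elim (pigeonhole a≢b b≢c c≢a (other-than a∈ p≢a) (other-than b∈ p≢b) (other-than c∈ p≢c))

  distinct-covered : ∀ {a b c p q r : A} → DecidableEquality A → a ≢ b → b ≢ c → c ≢ a →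
                     OneOf a p q r → OneOf b p q r → OneOf c p q r →
                     ∀ v → OneOf v p q r → OneOf v a b c
  distinct-covered _≟_ a≢b b≢c c≢a a∈ b∈ c∈ _ 1st =
    first-covered _≟_ a≢b b≢c c≢a a∈ b∈ c∈
  distinct-covered _≟_ a≢b b≢c c≢a a∈ b∈ c∈ _ 2nd =
    first-covered _≟_ a≢b b≢c c≢a (rotate a∈) (rotate b∈) (rotate c∈)
  distinct-covered _≟_ a≢b b≢c c≢a a∈ b∈ c∈ _ 3rd =
    first-covered _≟_ a≢b b≢c c≢a (rotate⁻¹ a∈) (rotate⁻¹ b∈) (rotate⁻¹ c∈)

module _ {n : ℕ} where

  fromDec : {P : Fin n → Set} → Decidable P → Subset n
  fromDec P? = tabulate (λ v → does (P? v))

  ∈-fromDec⁺ : {P : Fin n → Set} (P? : Decidable P) {v : Fin n} → P v → v ∈ fromDec P?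
  ∈-fromDec⁺ P? {v} p = lookup⇒[]= v _ (trans (lookup∘tabulate _ v) (dec-true (P? v) p))

  ∈-fromDec⁻ : {P : Fin n → Set} (P? : Decidable P) {v : Fin n} → v ∈ fromDec P? → P v
  ∈-fromDec⁻ P? {v} v∈ = witness (P? v) (trans (sym (lookup∘tabulate _ v)) ([]=⇒lookup v∈))
    where
    witness : ∀ {A : Set} (A? : Dec A) → does A? ≡ true → A
    witness (yes a) _ = a

  closure : (f : Subset n → Subset n) → (∀ {Y} → Y ⊆ f Y) →
            (P : Subset n → Set) → (∀ {Y} → P Y → P (f Y)) →
            ∀ {Y} → P Y → Σ[ X ∈ Subset n ] (Y ⊆ X × P X × f X ⊆ X)
  closure f inflationary P preserved {Y} pY = iterate Y (⊃-wellFounded Y) pY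
    where
    iterate : ∀ Y → Acc _⊃_ Y → P Y → Σ[ X ∈ Subset n ] (Y ⊆ X × P X × f X ⊆ X)
    iterate Y (acc larger) pY with Y ⊂? f Y
    ... | yes Y⊂fY with iterate (f Y) (larger Y⊂fY) (preserved pY)
    ...   | X , fY⊆X , pX , closed = X , (λ v∈Y → fY⊆X (inflationary v∈Y)) , pX , closed
    iterate Y _ pY | no Y⊄fY = Y , id , pY , closed
      where
      closed : f Y ⊆ Y
      closed {v} v∈fY with v ∈? Y
      ... | yes v∈Y = v∈Y
      ... | no v∉Y = ⊥-elim (Y⊄fY (inflationary , v , v∈fY , v∉Y))

module Tournament {n : ℕ} {E : Digraph n} (tournament : IsTournament E)
                  (E? : ∀ u v → Dec (E u v)) where
  open IsTournament tournament
  open CyclicTriangle using ()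
    renaming (a to first; b to second; c to third; ab to edge₁; bc to edge₂; ca to edge₃)

  Triangle : Set
  Triangle = CyclicTriangle E

  edge⇒≢ : ∀ {u v} → E u v → u ≢ v
  edge⇒≢ {u} uv refl = irrefl u uv

  reverse : ∀ {u v} → u ≢ v → ¬ E u v → E v u
  reverse {u} {v} u≢v ¬uv with total u v u≢v
  ... | inj₁ uv = ⊥-elim (¬uv uv)
  ... | inj₂ vu = vu

  data Orientation (u v : Fin n) : Set where
    equal    : u ≡ v → Orientation u v
    forward  : E u v → Orientation u v
    backward : E v u → Orientation u v

  orientation : ∀ u v → Orientation u v
  orientation u v with u ≟ v
  ... | yes u≡v = equal u≡v
  ... | no u≢v with total u v u≢v
  ...   | inj₁ uv = forward uv
  ...   | inj₂ vu = backward vu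

  _∈▵?_ : ∀ v (S : Triangle) → Dec (v ∈▵ S)
  v ∈▵? S = (v ≟ first S) ⊎-dec ((v ≟ second S) ⊎-dec (v ≟ third S))

  AllVertices : (Fin n → Set) → Triangle → Set
  AllVertices Q S = ∀ v → v ∈▵ S → Q v

  all-vertices : {Q : Fin n → Set} (S : Triangle) →
                 Q (first S) → Q (second S) → Q (third S) → AllVertices Q S
  all-vertices S q₁ q₂ q₃ _ 1st = q₁
  all-vertices S q₁ q₂ q₃ _ 2nd = q₂
  all-vertices S q₁ q₂ q₃ _ 3rd = q₃

  all-or-counterexample : {Q : Fin n → Set} → Decidable Q → (S : Triangle) →
                          AllVertices Q S ⊎ ∃ λ z → z ∈▵ S × ¬ Q z
  all-or-counterexample Q? S with Q? (first S) | Q? (second S) | Q? (third S)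
  ... | yes q₁ | yes q₂ | yes q₃ = inj₁ (all-vertices S q₁ q₂ q₃)
  ... | no ¬q₁ | _      | _      = inj₂ (first S , 1st , ¬q₁)
  ... | yes _  | no ¬q₂ | _      = inj₂ (second S , 2nd , ¬q₂)
  ... | yes _  | yes _  | no ¬q₃ = inj₂ (third S , 3rd , ¬q₃)

  SameTriangle-refl : (S : Triangle) → SameTriangle S S
  SameTriangle-refl S v = id , id

  SameTriangle-sym : (S U : Triangle) → SameTriangle S U → SameTriangle U S
  SameTriangle-sym S U S≈U v = proj₂ (S≈U v) , proj₁ (S≈U v)

  SameTriangle-trans : (S U W : Triangle) → SameTriangle S U → SameTriangle U W → SameTriangle S W
  SameTriangle-trans S U W S≈U U≈W v =
    (λ v∈S → proj₁ (U≈W v) (proj₁ (S≈U v) v∈S)) , (λ v∈W → proj₂ (S≈U v) (proj₂ (U≈W v) v∈W))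

  rotate-to : (S : Triangle) {v : Fin n} → v ∈▵ S → Σ[ U ∈ Triangle ] (first U ≡ v × SameTriangle S U)
  rotate-to S 1st = S , refl , SameTriangle-refl S
  rotate-to (cyc a b c ab bc ca) 2nd = cyc b c a bc ca ab , refl , λ v → rotate , rotate⁻¹
  rotate-to (cyc a b c ab bc ca) 3rd = cyc c a b ca ab bc , refl , λ v → rotate⁻¹ , rotate

  Adjacent-respˡ : (S S′ U : Triangle) → SameTriangle S S′ → Adjacent S U → Adjacent S′ U
  Adjacent-respˡ S S′ U S≈S′ ((x , y , x≢y , x∈S , x∈U , y∈S , y∈U) , (z , z∈S , z∉U)) =
    (x , y , x≢y , proj₁ (S≈S′ x) x∈S , x∈U , proj₁ (S≈S′ y) y∈S , y∈U) , (z , proj₁ (S≈S′ z) z∈S , z∉U)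

  TriConn-respˡ : (S S′ U : Triangle) → SameTriangle S S′ → TriConn S U → TriConn S′ U
  TriConn-respˡ S S′ U S≈S′ (tc-same S≈U) =
    tc-same (SameTriangle-trans S′ S U (SameTriangle-sym S S′ S≈S′) S≈U)
  TriConn-respˡ S S′ U S≈S′ (tc-step {D = D} S~D D~U) = tc-step (Adjacent-respˡ S S′ D S≈S′ S~D) D~U

  TriConn-refl : (S : Triangle) → TriConn S S
  TriConn-refl S = tc-same (SameTriangle-refl S)

  TriConn-trans : {S U W : Triangle} → TriConn S U → TriConn U W → TriConn S W
  TriConn-trans {S} {U} (tc-same S≈U) U~W = TriConn-respˡ U S _ (SameTriangle-sym S U S≈U) U~W
  TriConn-trans (tc-step S~D D~U) U~W = tc-step S~D (TriConn-trans D~U U~W)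

  infixr 2 _∼⟨_⟩_
  infix  3 _∎

  _∼⟨_⟩_ : (S : Triangle) {U W : Triangle} → TriConn S U → TriConn U W → TriConn S W
  S ∼⟨ S~U ⟩ U~W = TriConn-trans S~U U~W

  _∎ : (S : Triangle) → TriConn S S
  _∎ = TriConn-refl

  TriConn-sharing : {S U : Triangle} {x y : Fin n} → x ≢ y →
                    x ∈▵ S → y ∈▵ S → x ∈▵ U → y ∈▵ U → TriConn S U
  TriConn-sharing {S} {U} x≢y x∈S y∈S x∈U y∈U with all-or-counterexample (_∈▵? U) S
  ... | inj₁ S⊆U = tc-same λ v → S⊆U v , distinct-covered _≟_
          (edge⇒≢ (edge₁ S)) (edge⇒≢ (edge₂ S)) (edge⇒≢ (edge₃ S)) (S⊆U _ 1st) (S⊆U _ 2nd) (S⊆U _ 3rd) v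
  ... | inj₂ (z , z∈S , z∉U) =
    tc-step ((_ , _ , x≢y , x∈S , x∈U , y∈S , y∈U) , z , z∈S , z∉U) (TriConn-refl U)

  TriConn-sharing-edge : {S U : Triangle} {x y : Fin n} → E x y →
                         x ∈▵ S → y ∈▵ S → x ∈▵ U → y ∈▵ U → TriConn S U
  TriConn-sharing-edge xy = TriConn-sharing (edge⇒≢ xy)

  TriConn-sym : {S U : Triangle} → TriConn S U → TriConn U S
  TriConn-sym {S} {U} (tc-same S≈U) = tc-same (SameTriangle-sym S U S≈U)
  TriConn-sym (tc-step ((x , y , x≢y , x∈S , x∈D , y∈S , y∈D) , _) D~U) =
    TriConn-trans (TriConn-sym D~U) (TriConn-sharing x≢y x∈D y∈D x∈S y∈S)

  Reaches : Triangle → (Triangle → Set) → Set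
  Reaches S Goal = Σ[ U ∈ Triangle ] (TriConn S U × Goal U)

  reaches-via : ∀ {S U Goal} → TriConn S U → Reaches U Goal → Reaches S Goal
  reaches-via S~U (W , U~W , goal) = W , TriConn-trans S~U U~W , goal

  reaches-self : ∀ {Goal} (S : Triangle) → Goal S → Reaches S Goal
  reaches-self S goal = S , TriConn-refl S , goal

  reaches-cone : (S : Triangle) {u v w : Fin n} → E u w → E v u → E w v →
                 u ∈▵ S → w ∈▵ S → Reaches S (v ∈▵_)
  reaches-cone S uw vu wv u∈S w∈S = cyc _ _ _ vu uw wv , TriConn-sharing-edge uw u∈S w∈S 2nd 3rd , 1st

  -- If v is on neither side of S, then going round S some edge u → w has v → u and w → v.
  reaches-splitting : (S : Triangle) {v : Fin n} →
                      (∃ λ x → x ∈▵ S × ¬ E x v) → (∃ λ y → y ∈▵ S × ¬ E v y) → Reaches S (v ∈▵_)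
  reaches-splitting S {v} (x , x∈S , ¬xv) (y , y∈S , ¬vy) with v ∈▵? S
  ... | yes v∈S = reaches-self S v∈S
  ... | no v∉S with side (first S) 1st | side (second S) 2nd | side (third S) 3rd
    where
    side : ∀ u → u ∈▵ S → E v u ⊎ E u v
    side u u∈S = total v u λ { refl → v∉S u∈S }
  ... | inj₁ va | inj₁ vb | inj₁ vc = ⊥-elim (¬vy (all-vertices S va vb vc y y∈S))
  ... | inj₂ av | inj₂ bv | inj₂ cv = ⊥-elim (¬xv (all-vertices {λ u → E u v} S av bv cv x x∈S))
  ... | inj₁ va | inj₂ bv | _       = reaches-cone S (edge₁ S) va bv 1st 2nd
  ... | _       | inj₁ vb | inj₂ cv = reaches-cone S (edge₂ S) vb cv 2nd 3rd
  ... | inj₂ av | _       | inj₁ vc = reaches-cone S (edge₃ S) vc av 3rd 1st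

  FrontierReaches : (Fin n → Set) → (Triangle → Set) → Set
  FrontierReaches Q Goal = ∀ U → ¬ Q (first U) → Q (second U) → Q (third U) → Reaches U Goal

  other-two : {Q : Fin n → Set} (U : Triangle) {x y : Fin n} → x ≢ y → x ∈▵ U → y ∈▵ U →
              Q x → Q y → ¬ Q (first U) → Q (second U) × Q (third U)
  other-two U _   1st _   qx _  ¬q₁ = ⊥-elim (¬q₁ qx)
  other-two U _   _   1st _  qy ¬q₁ = ⊥-elim (¬q₁ qy)
  other-two U x≢y 2nd 2nd _  _  _   = ⊥-elim (x≢y refl)
  other-two U _   2nd 3rd qx qy _   = qx , qy
  other-two U _   3rd 2nd qx qy _   = qy , qx
  other-two U x≢y 3rd 3rd _  _  _   = ⊥-elim (x≢y refl)

  frontier-reaches : {Q : Fin n → Set} {Goal : Triangle → Set} → FrontierReaches Q Goal →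
                     (S : Triangle) {x y z : Fin n} → x ≢ y → x ∈▵ S → y ∈▵ S → z ∈▵ S →
                     Q x → Q y → ¬ Q z → Reaches S Goal
  frontier-reaches frontier S x≢y x∈S y∈S z∈S qx qy ¬qz with rotate-to S z∈S
  ... | U , refl , S≈U = reaches-via (tc-same S≈U)
    (uncurry (frontier U ¬qz) (other-two U x≢y (proj₁ (S≈U _) x∈S) (proj₁ (S≈U _) y∈S) qx qy ¬qz))

  -- A chain of adjacent triangles that starts inside Q and ends outside it has to cross the
  -- frontier, and the first triangle beyond the frontier shares two Q-vertices with its predecessor.
  escape-reaches : {Q : Fin n → Set} {Goal : Triangle → Set} → Decidable Q → FrontierReaches Q Goal →
                   {S R : Triangle} → AllVertices Q S → TriConn S R →
                   (∃ λ z → z ∈▵ R × ¬ Q z) → Reaches S Goal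
  escape-reaches Q? frontier S⊆Q (tc-same S≈R) (z , z∈R , ¬qz) =
    ⊥-elim (¬qz (S⊆Q z (proj₂ (S≈R z) z∈R)))
  escape-reaches Q? frontier S⊆Q
    (tc-step {D = D} S~D@((x , y , x≢y , x∈S , x∈D , y∈S , y∈D) , _) D~R) escape with all-or-counterexample Q? D
  ... | inj₁ D⊆Q = reaches-via (tc-step S~D (TriConn-refl D)) (escape-reaches Q? frontier D⊆Q D~R escape)
  ... | inj₂ (z , z∈D , ¬qz) = reaches-via (tc-step S~D (TriConn-refl D))
    (frontier-reaches frontier D x≢y x∈D y∈D z∈D (S⊆Q x x∈S) (S⊆Q y y∈S) ¬qz)

  reachable-between : (B : Triangle) {v x y : Fin n} → E v x → E y v →
                      Reaches B (x ∈▵_) → Reaches B (y ∈▵_) → Reaches B (v ∈▵_)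
  reachable-between B {v} {x} {y} vx yv (_ , B~Tx , x∈Tx) (_ , B~Ty , y∈Ty)
    with all-or-counterexample (E? v) B | all-or-counterexample (λ u → E? u v) B
  ... | inj₁ v⇒B | _ = escape-reaches (E? v) frontier-out v⇒B B~Ty (y , y∈Ty , antisym y v yv)
    where
    frontier-out : FrontierReaches (E v) (v ∈▵_)
    frontier-out U ¬va vb _ = reaches-splitting U (_ , 2nd , antisym v _ vb) (_ , 1st , ¬va)
  ... | inj₂ _ | inj₁ B⇒v = escape-reaches (λ u → E? u v) frontier-in B⇒v B~Tx (x , x∈Tx , antisym v x vx)
    where
    frontier-in : FrontierReaches (λ u → E u v) (v ∈▵_)
    frontier-in U ¬av bv _ = reaches-splitting U (_ , 1st , ¬av) (_ , 2nd , antisym _ v bv)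
  ... | inj₂ (y′ , y′∈B , ¬vy′) | inj₂ (x′ , x′∈B , ¬x′v) =
    reaches-splitting B (x′ , x′∈B , ¬x′v) (y′ , y′∈B , ¬vy′)

  Mixed : Subset n → Fin n → Set
  Mixed X v = (∃ λ x → x ∈ X × E v x) × (∃ λ y → y ∈ X × E y v)

  mixed? : (X : Subset n) → Decidable (Mixed X)
  mixed? X v = any? (λ x → (x ∈? X) ×-dec E? v x) ×-dec any? (λ y → (y ∈? X) ×-dec E? y v)

  in-or-mixed? : (X : Subset n) → Decidable (λ v → v ∈ X ⊎ Mixed X v)
  in-or-mixed? X v = (v ∈? X) ⊎-dec mixed? X v

  add-mixed : Subset n → Subset n
  add-mixed X = fromDec (in-or-mixed? X)

  ⊆-add-mixed : {X : Subset n} → X ⊆ add-mixed X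
  ⊆-add-mixed {X} v∈X = ∈-fromDec⁺ (in-or-mixed? X) (inj₁ v∈X)

  add-mixed-closed⇒homogeneous : {X : Subset n} → add-mixed X ⊆ X → Homogeneous E X
  add-mixed-closed⇒homogeneous {X} closed v v∉X with any? (λ x → (x ∈? X) ×-dec ¬? (E? v x))
  ... | no ∄x = inj₁ λ x x∈X → decidable-stable (E? v x) λ ¬vx → ∄x (x , x∈X , ¬vx)
  ... | yes (x , x∈X , ¬vx) = inj₂ λ y y∈X → decidable-stable (E? y v) λ ¬yv →
    v∉X (closed (∈-fromDec⁺ (in-or-mixed? X)
      (inj₂ ((y , y∈X , reverse (apart y∈X ∘′ sym) ¬yv) , (x , x∈X , reverse (apart x∈X) ¬vx)))))
    where
    apart : ∀ {u} → u ∈ X → v ≢ u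
    apart u∈X refl = v∉X u∈X

  AllReachable : Triangle → Subset n → Set
  AllReachable B X = ∀ v → v ∈ X → Reaches B (v ∈▵_)

  add-mixed-reachable : (B : Triangle) {X : Subset n} →
                        AllReachable B X → AllReachable B (add-mixed X)
  add-mixed-reachable B {X} X-reachable v v∈ with ∈-fromDec⁻ (in-or-mixed? X) v∈
  ... | inj₁ v∈X = X-reachable v v∈X
  ... | inj₂ ((x , x∈X , vx) , (y , y∈X , yv)) =
    reachable-between B vx yv (X-reachable x x∈X) (X-reachable y y∈X)

  Completes : Fin n → Fin n → Fin n → Set
  Completes p q w = E q w × E w p

  completes? : ∀ p q → Decidable (Completes p q)
  completes? p q w = E? q w ×-dec E? w p

  completing : ∀ {p q w} → E p q → Completes p q w → Triangle
  completing pq (qw , wp) = cyc _ _ _ wp pq qw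

  reaches-completing : ∀ {p q w} (pq : E p q) (w-completes : Completes p q w) {S : Triangle} →
                       TriConn S (completing pq w-completes) → Reaches S (λ W → p ∈▵ W × q ∈▵ W)
  reaches-completing _ _ S~W = _ , S~W , 2nd , 3rd

  frontier-completes : ∀ {p q} → E p q → FrontierReaches (Completes p q) (λ W → p ∈▵ W × q ∈▵ W)
  frontier-completes {p} {q} pq
    U@(cyc a b c ab _ ca) ¬completes b-completes@(qb , bp) c-completes@(qc , _)
    with orientation a p
  ... | equal refl =
    reaches-completing pq b-completes (TriConn-sharing-edge ab 1st 2nd 2nd 1st)
  ... | backward pa = reaches-completing pq b-completes
    (U ∼⟨ TriConn-sharing-edge ab 1st 2nd 2nd 3rd ⟩ cyc p a b pa ab bp
       ∼⟨ TriConn-sharing-edge bp 3rd 1st 1st 2nd ⟩ completing pq b-completes ∎)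
  ... | forward ap with orientation a q
  ...   | equal refl =
    reaches-completing pq b-completes (TriConn-sharing-edge ab 1st 2nd 3rd 1st)
  ...   | forward aq = reaches-completing pq c-completes
    (U ∼⟨ TriConn-sharing-edge ca 3rd 1st 2nd 3rd ⟩ cyc q c a qc ca aq
       ∼⟨ TriConn-sharing-edge qc 1st 2nd 3rd 1st ⟩ completing pq c-completes ∎)
  ...   | backward qa = ⊥-elim (¬completes (qa , ap))

  module _ (prime : Prime E) where

    every-vertex-reachable : (B : Triangle) (v : Fin n) → Reaches B (v ∈▵_)
    every-vertex-reachable B v
      with closure add-mixed ⊆-add-mixed (AllReachable B) (add-mixed-reachable B) {fromDec (_∈▵? B)}
             (λ u u∈B → reaches-self B (∈-fromDec⁻ (_∈▵? B) u∈B))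
    ... | X , B⊆X , X-reachable , closed = X-reachable v (subst (v ∈_) (sym X≡⊤) ∈⊤)
      where
      a∈X : first B ∈ X
      a∈X = B⊆X (∈-fromDec⁺ (_∈▵? B) 1st)
      b∈X : second B ∈ X
      b∈X = B⊆X (∈-fromDec⁺ (_∈▵? B) 2nd)
      1<∣X∣ : 1 < ∣ X ∣
      1<∣X∣ = subst (_< ∣ X ∣) (∣⁅x⁆∣≡1 (first B)) (p⊂q⇒∣p∣<∣q∣
        ( (λ u∈⁅a⁆ → subst (_∈ X) (sym (x∈⁅y⁆⇒x≡y _ u∈⁅a⁆)) a∈X)
        , second B , b∈X , x≢y⇒x∉⁅y⁆ (edge⇒≢ (edge₁ B) ∘′ sym)))
      X≡⊤ : X ≡ ⊤
      X≡⊤ = ∣p∣≡n⇒p≡⊤ (≤-antisym (∣p∣≤n X)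
        (≮⇒≥ λ ∣X∣<n → prime X (add-mixed-closed⇒homogeneous closed) (1<∣X∣ , ∣X∣<n)))

    TriConn-completing : ∀ {p q} → E p q → (T D : Triangle) →
                         AllVertices (Completes p q) T → p ∈▵ D → q ∈▵ D → TriConn T D
    TriConn-completing {p} pq T D T-completes p∈D q∈D with every-vertex-reachable T p
    ... | R , T~R , p∈R with escape-reaches (completes? p _) (frontier-completes pq) T-completes T~R
                               (p , p∈R , λ (_ , pp) → irrefl p pp)
    ...   | W , T~W , p∈W , q∈W = T ∼⟨ T~W ⟩ W ∼⟨ TriConn-sharing-edge pq p∈W q∈W p∈D q∈D ⟩ D ∎

    TriConn-common-apex : (T D : Triangle) → first T ≡ first D → TriConn T D
    TriConn-common-apex T@(cyc a p₁ q₁ ap₁ p₁q₁ q₁a) D@(cyc _ p₂ q₂ ap₂ p₂q₂ q₂a) refl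
      with orientation p₁ q₂ | orientation p₂ q₁
    ... | equal refl | _ = TriConn-sharing-edge ap₁ 1st 2nd 1st 3rd
    ... | forward p₁q₂ | _ =
      T ∼⟨ TriConn-sharing-edge ap₁ 1st 2nd 1st 2nd ⟩ cyc a p₁ q₂ ap₁ p₁q₂ q₂a
        ∼⟨ TriConn-sharing-edge q₂a 3rd 1st 3rd 1st ⟩ D ∎
    ... | _ | equal refl = TriConn-sharing-edge q₁a 3rd 1st 2nd 1st
    ... | _ | forward p₂q₁ =
      T ∼⟨ TriConn-sharing-edge q₁a 3rd 1st 3rd 1st ⟩ cyc a p₂ q₁ ap₂ p₂q₁ q₁a
        ∼⟨ TriConn-sharing-edge ap₂ 1st 2nd 1st 2nd ⟩ D ∎
    ... | backward q₂p₁ | backward q₁p₂ with orientation p₁ p₂ | orientation q₁ q₂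
    ...   | equal refl | _ = TriConn-sharing-edge ap₁ 1st 2nd 1st 2nd
    ...   | _ | equal refl = TriConn-sharing-edge q₁a 3rd 1st 3rd 1st
    ...   | forward p₁p₂ | forward q₁q₂ =
      T ∼⟨ TriConn-sharing-edge p₁q₁ 2nd 3rd 3rd 1st ⟩ cyc q₁ q₂ p₁ q₁q₂ q₂p₁ p₁q₁
        ∼⟨ TriConn-sharing-edge q₂p₁ 2nd 3rd 3rd 1st ⟩ cyc p₁ p₂ q₂ p₁p₂ p₂q₂ q₂p₁
        ∼⟨ TriConn-sharing-edge p₂q₂ 2nd 3rd 2nd 3rd ⟩ D ∎
    ...   | backward p₂p₁ | backward q₂q₁ =
      T ∼⟨ TriConn-sharing-edge p₁q₁ 2nd 3rd 2nd 3rd ⟩ cyc p₂ p₁ q₁ p₂p₁ p₁q₁ q₁p₂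
        ∼⟨ TriConn-sharing-edge q₁p₂ 3rd 1st 2nd 3rd ⟩ cyc q₂ q₁ p₂ q₂q₁ q₁p₂ p₂q₂
        ∼⟨ TriConn-sharing-edge p₂q₂ 3rd 1st 2nd 3rd ⟩ D ∎
    ...   | forward p₁p₂ | backward q₂q₁ =
      TriConn-completing p₂q₂ T D (all-vertices T (q₂a , ap₂) (q₂p₁ , p₁p₂) (q₂q₁ , q₁p₂)) 2nd 3rd
    ...   | backward p₂p₁ | forward q₁q₂ = TriConn-sym
      (TriConn-completing p₁q₁ D T (all-vertices D (q₁a , ap₁) (q₁p₂ , p₂p₁) (q₁q₂ , q₂p₁)) 2nd 3rd)

    triangle-connected : (C D : Triangle) → TriConn C D
    triangle-connected C D with every-vertex-reachable C (first D)
    ... | T , C~T , d∈T with rotate-to T d∈T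
    ...   | U , U-apex , T≈U =
      C ∼⟨ C~T ⟩ T ∼⟨ tc-same T≈U ⟩ U ∼⟨ TriConn-common-apex U D U-apex ⟩ D ∎

theorem4p1 : (n : ℕ) (G : Adj n) → IsTournament (edge G) → StronglyConnected (edge G) → Prime (edge G) → TriangleConnected (edge G)
theorem4p1 n G tournament strong prime =
  strong , Tournament.triangle-connected tournament (λ u v → T? (G u v)) prime
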